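{- In Single-delete Nim with four piles, let $P$ be the set of positions $\langle w,x,y,z\rangle$ whose standardization satisfies one of conditions (1)–(5) below. If a position belongs to $P$, then no single move leads from it to a position in $P$. Conditions, for a standardized position $\langle w,x,y,z\rangle$ with $a=v_2(w)\le b=v_2(x)\le c=v_2(y)\le d=v_2(z)$: (1) $a=b=c=d$. (2) $a<b=c=d$ and $I_{b+1}(w)=0$. (3) $a<b<c=d$, $I_{c+1}(w)=I_{c+1}(x)=0$, $I_{k}(w)+I_{k}(x)\geq 1$ for all $b+2\leq k\leq c$, and $I_{b+1}(w)=1$. (4) $a<b<c<d$, $I_{d+1}(w)=I_{d+1}(x)=I_{d+1}(y)=0$, $I_{j}(w)+I_{j}(x)+I_{j}(y)\geq 2$ for all $c+2\leq j\leq d$, $I_{c+1}(w)=I_{c+1}(x)=1$, $I_{k}(w)+I_{k}(x)\geq 1$ for all $b+2\leq k\leq c$, and $I_{b+1}(w)=1$. (5) $a<b<c<d$, $I_{i}(w)+I_{i}(x)+I_{i}(y)+I_{i}(z)\in\{0,3,4\}$ for all $i\geq d+2$, $I_{d+1}(w)=I_{d+1}(x)=I_{d+1}(y)=1$, $I_{j}(w)+I_{j}(x)+I_{j}(y)\geq 2$ for all $c+2\leq j\leq d$, $I_{c+1}(w)=I_{c+1}(x)=1$, $I_{k}(w)+I_{k}(x)\geq 1$ for all $b+2\leq k\leq c$, and $I_{b+1}(w)=1$.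
   Context: $\mathbb{N}$ denotes the positive integers. Single-delete Nim with four piles: a position is four piles of stones with positive sizes $\langle w,x,y,z\rangle$. A move consists of removing one pile entirely and then splitting one of the remaining three piles into two piles each with at least one stone, giving again four piles. For $z\in\mathbb{N}$, $v_2(z)$ is the exponent of the largest power of $2$ dividing $z$. $I_k(z)=\lfloor z/2^{k-1}\rfloor \bmod 2$ is the $k$-th binary digit from the right. The standardization of a position is the rearrangement $\langle w,x,y,z\rangle$ of its piles such that $v_2(w)\le v_2(x)\le v_2(y)\le v_2(z)$. -}

module Defs where

open import Data.Nat using (ℕ; zero; suc; _+_; _^_; _≤_; _<_; _∸_)
open import Data.Nat.DivMod using (_/_; _%_)
open import Data.Nat.Divisibility using (_∣_)
open import Data.Nat.Properties using (m^n≢0)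
open import Data.List using (List; []; _∷_)
open import Data.List.Relation.Binary.Permutation.Propositional using (_↭_)
open import Data.Product using (_×_; ∃-syntax)
open import Data.Sum using (_⊎_)
open import Relation.Nullary using (¬_)
open import Relation.Binary.PropositionalEquality using (_≡_)

V2 : ℕ → ℕ → Set
V2 z k = (2 ^ k ∣ z) × ¬ (2 ^ suc k ∣ z)

-- I k z = ⌊ z / 2^(k-1) ⌋ mod 2   (k-th binary digit from the right, k ≥ 1)
I : ℕ → ℕ → ℕ
I k z = (z / (2 ^ (k ∸ 1))) {{m^n≢0 2 (k ∸ 1)}} % 2

-- A position is an ordered 4-tuple of piles (order is irrelevant for all notions below).
record Pos : Set where
  constructor ⟨_,_,_,_⟩
  field
    p₁ p₂ p₃ p₄ : ℕ

toList : Pos → List ℕ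
toList ⟨ w , x , y , z ⟩ = w ∷ x ∷ y ∷ z ∷ []

Valid : Pos → Set
Valid ⟨ w , x , y , z ⟩ = (1 ≤ w) × (1 ≤ x) × (1 ≤ y) × (1 ≤ z)

-- A move: remove pile r, split pile s into m + n (m, n ≥ 1); t, u are the untouched piles.
Move : Pos → Pos → Set
Move p q = ∃[ r ] ∃[ s ] ∃[ t ] ∃[ u ] ∃[ m ] ∃[ n ]
  ( (toList p ↭ (r ∷ s ∷ t ∷ u ∷ []))
  × (1 ≤ m) × (1 ≤ n) × (m + n ≡ s)
  × (toList q ↭ (t ∷ u ∷ m ∷ n ∷ [])) )

Cond : ℕ → ℕ → ℕ → ℕ → ℕ → ℕ → ℕ → ℕ → Set
Cond w x y z a b c d =
    (a ≡ b × b ≡ c × c ≡ d)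
  ⊎ (a < b × b ≡ c × c ≡ d × I (suc b) w ≡ 0)
  ⊎ (a < b × b < c × c ≡ d
     × I (suc c) w ≡ 0 × I (suc c) x ≡ 0
     × (∀ k → b + 2 ≤ k → k ≤ c → 1 ≤ I k w + I k x)
     × I (suc b) w ≡ 1)
  ⊎ (a < b × b < c × c < d
     × I (suc d) w ≡ 0 × I (suc d) x ≡ 0 × I (suc d) y ≡ 0
     × (∀ j → c + 2 ≤ j → j ≤ d → 2 ≤ I j w + I j x + I j y)
     × I (suc c) w ≡ 1 × I (suc c) x ≡ 1
     × (∀ k → b + 2 ≤ k → k ≤ c → 1 ≤ I k w + I k x)
     × I (suc b) w ≡ 1)
  ⊎ (a < b × b < c × c < d
     × (∀ i → d + 2 ≤ i →
          let s = I i w + I i x + I i y + I i z in (s ≡ 0 ⊎ s ≡ 3 ⊎ s ≡ 4))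
     × I (suc d) w ≡ 1 × I (suc d) x ≡ 1 × I (suc d) y ≡ 1
     × (∀ j → c + 2 ≤ j → j ≤ d → 2 ≤ I j w + I j x + I j y)
     × I (suc c) w ≡ 1 × I (suc c) x ≡ 1
     × (∀ k → b + 2 ≤ k → k ≤ c → 1 ≤ I k w + I k x)
     × I (suc b) w ≡ 1)

-- p ∈ P: some standardization ⟨w,x,y,z⟩ of p (a rearrangement of its piles with
-- v₂(w) ≤ v₂(x) ≤ v₂(y) ≤ v₂(z)) satisfies one of (1)–(5).
InP : Pos → Set
InP p = ∃[ w ] ∃[ x ] ∃[ y ] ∃[ z ] ∃[ a ] ∃[ b ] ∃[ c ] ∃[ d ]
  ( (toList p ↭ (w ∷ x ∷ y ∷ z ∷ []))
  × V2 w a × V2 x b × V2 y c × V2 z d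
  × a ≤ b × b ≤ c × c ≤ d
  × Cond w x y z a b c d )

{-# OPTIONS --safe #-}
module Submission where

-- Reading the binary digits of a standardized position column by column from the
-- least significant end, membership in P is recognised by a six-state automaton: the
-- columns below a are 0000, the column at a separates (1) from the other cases, and so
-- on up to d, beyond which only the column sums of (5) are constrained.
-- A move ⟨r,s,t,u⟩ ↦ ⟨t,u,m,n⟩ with s = m + n is followed column by column by running
-- the automaton on both positions at once, computing the digits of s from those of m
-- and n and a carry. For each of the 24 × 24 ways to arrange the piles of the two
-- positions, the finitely many reachable joint states are computed and checked by
-- evaluation: none has both runs accepting with carry 0. Yet if both positions were in
-- P, both runs would accept at any K beyond d, d′ and the length of s, where the carry
-- is 0.

open import Defs
open import Data.Bool using (if_then_else_)
open import Data.Empty using (⊥)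
open import Data.Fin using (Fin; zero; suc)
import Data.Fin as Fin
open import Data.Fin.Properties using (all?)
open import Data.List using (List; []; _∷_; _++_; [_]; concatMap; filter; deduplicate; fromMaybe)
import Data.List as List
open import Data.List.Membership.Propositional using (_∈_)
open import Data.List.Relation.Binary.Permutation.Propositional using (_↭_; ↭-sym; ↭-trans; ↭⇒↭ₛ)
open import Data.List.Relation.Unary.All as All using (All)
open import Data.Maybe using (Maybe; just; nothing; _>>=_; zipWith)
import Data.Maybe.Relation.Unary.All as Maybe
open import Data.Nat using (ℕ; zero; suc; _+_; _*_; _^_; _∸_; _≤_; _<_; z≤n; s≤s; s≤s⁻¹; s<s; _≤?_)
open import Data.Nat.DivMod
open import Data.Nat.Divisibility
  using (_∣_; divides; n∣m⇒m%n≡0; m%n≡0⇒n∣m; ∣-trans; n∣m*n; m∣m*n; *-monoˡ-∣)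
open import Data.Nat.Properties
open import Data.Nat.Solver using (module +-*-Solver)
open import Data.Product using (_×_; _,_; proj₁; proj₂; ∃-syntax)
open import Data.Product.Properties using (≡-dec)
open import Data.Sum using (_⊎_; inj₁; inj₂)
open import Data.Vec using (Vec; []; _∷_; map; lookup; tabulate; fromList)
open import Data.Vec.Properties using (map-∘; map-cong; lookup-map; tabulate∘lookup; tabulate-cong; tabulate-∘)
open import Data.Vec.Relation.Unary.AllPairs using (allPairs?)
open import Data.Vec.Relation.Unary.Unique.Propositional using (Unique)
open import Data.Vec.Relation.Unary.Unique.Propositional.Properties using (tabulate⁺)
open import Function using (_∘_; mk↣; Inverse; Injection)
open import Function.Properties.Inverse using (↔⇒↣)
open import Level using (0ℓ)
open import Relation.Binary.Definitions using (DecidableEquality)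
open import Relation.Binary.PropositionalEquality
  using (_≡_; refl; sym; trans; cong; cong₂; subst; module ≡-Reasoning)
open import Relation.Nullary using (¬_; contradiction)
open import Relation.Nullary.Decidable
  using (Dec; yes; no; does; map′; dec-true; from-yes; ¬?; _×-dec_; _⊎-dec_; _→-dec_)
open import Relation.Unary using (Pred; Decidable)

⌊_/2^_⌋ : ℕ → ℕ → ℕ
⌊ z /2^ k ⌋ = (z / 2 ^ k) {{m^n≢0 2 k}}

⌊m/2^[1+k]⌋≡⌊m/2^k⌋/2 : ∀ m k → ⌊ m /2^ suc k ⌋ ≡ ⌊ m /2^ k ⌋ / 2
⌊m/2^[1+k]⌋≡⌊m/2^k⌋/2 m k = begin
  ⌊ m /2^ suc k ⌋               ≡⟨ /-congʳ {{m^n≢0 2 (suc k)}} {{2^k*2≢0}} (*-comm 2 (2 ^ k)) ⟩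
  (m / (2 ^ k * 2)) {{2^k*2≢0}} ≡⟨ m/n/o≡m/[n*o] m (2 ^ k) 2 {{m^n≢0 2 k}} {{_}} {{2^k*2≢0}} ⟨
  ⌊ m /2^ k ⌋ / 2               ∎
  where
    open ≡-Reasoning
    2^k*2≢0 = m*n≢0 (2 ^ k) 2 {{m^n≢0 2 k}}

⌊m*2^[n+k]/2^k⌋≡m*2^n : ∀ m n k → ⌊ m * 2 ^ (n + k) /2^ k ⌋ ≡ m * 2 ^ n
⌊m*2^[n+k]/2^k⌋≡m*2^n m n k = begin
  ⌊ m * 2 ^ (n + k) /2^ k ⌋     ≡⟨ cong (λ e → ⌊ m * e /2^ k ⌋) (^-distribˡ-+-* 2 n k) ⟩
  ⌊ m * (2 ^ n * 2 ^ k) /2^ k ⌋ ≡⟨ cong ⌊_/2^ k ⌋ (*-assoc m (2 ^ n) (2 ^ k)) ⟨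
  ⌊ m * 2 ^ n * 2 ^ k /2^ k ⌋   ≡⟨ m*n/n≡m (m * 2 ^ n) (2 ^ k) {{m^n≢0 2 k}} ⟩
  m * 2 ^ n                     ∎
  where open ≡-Reasoning

I-below-valuation : ∀ {z} v {k} → 2 ^ v ∣ z → k < v → I (suc k) z ≡ 0
I-below-valuation v {k} (divides q refl) k<v =
  n∣m⇒m%n≡0 _ 2 (subst (2 ∣_) (sym ⌊q*2^v/2^k⌋≡q*2^[1+e]) (∣-trans (m∣m*n (2 ^ e)) (n∣m*n q)))
  where
    e = v ∸ suc k
    1+e+k≡v : suc e + k ≡ v
    1+e+k≡v = trans (sym (+-suc e k)) (m∸n+n≡m k<v)
    ⌊q*2^v/2^k⌋≡q*2^[1+e] : ⌊ q * 2 ^ v /2^ k ⌋ ≡ q * 2 ^ suc e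
    ⌊q*2^v/2^k⌋≡q*2^[1+e] =
      trans (cong (λ i → ⌊ q * 2 ^ i /2^ k ⌋) (sym 1+e+k≡v)) (⌊m*2^[n+k]/2^k⌋≡m*2^n q (suc e) k)

I-at-valuation : ∀ {z} v → V2 z v → I (suc v) z ≡ 1
I-at-valuation v (divides q refl , 2^[1+v]∤z) with q % 2 in q%2 | m%n<n q 2
... | 1 | _ = trans (cong (_% 2) (trans (⌊m*2^[n+k]/2^k⌋≡m*2^n q 0 v) (*-identityʳ q))) q%2
... | 0 | _ = contradiction (*-monoˡ-∣ (2 ^ v) (m%n≡0⇒n∣m q 2 q%2)) 2^[1+v]∤z
... | suc (suc _) | s<s (s<s ())

I<2 : ∀ k z → I (suc k) z < 2
I<2 k z = m%n<n ⌊ z /2^ k ⌋ 2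

carry : ℕ → ℕ → ℕ → ℕ
carry m n zero    = 0
carry m n (suc k) = (I (suc k) m + I (suc k) n + carry m n k) / 2

m+n+c≡[m%2+n%2+c]+[m/2+n/2]*2 : ∀ m n c → m + n + c ≡ (m % 2 + n % 2 + c) + (m / 2 + n / 2) * 2
m+n+c≡[m%2+n%2+c]+[m/2+n/2]*2 m n c = begin
  m + n + c
    ≡⟨ cong₂ (λ i j → i + j + c) (m≡m%n+[m/n]*n m 2) (m≡m%n+[m/n]*n n 2) ⟩
  (m % 2 + m / 2 * 2) + (n % 2 + n / 2 * 2) + c
    ≡⟨ regroup (m % 2) (m / 2) (n % 2) (n / 2) c ⟩
  (m % 2 + n % 2 + c) + (m / 2 + n / 2) * 2
    ∎
  where
    open ≡-Reasoning
    open +-*-Solver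
    regroup = solve 5 (λ i i′ j j′ c → (i :+ i′ :* con 2) :+ (j :+ j′ :* con 2) :+ c
                                       := (i :+ j :+ c) :+ (i′ :+ j′) :* con 2) refl

[m+n+c]%2≡[m%2+n%2+c]%2 : ∀ m n c → (m + n + c) % 2 ≡ (m % 2 + n % 2 + c) % 2
[m+n+c]%2≡[m%2+n%2+c]%2 m n c =
  trans (cong (_% 2) (m+n+c≡[m%2+n%2+c]+[m/2+n/2]*2 m n c))
        ([m+kn]%n≡m%n (m % 2 + n % 2 + c) (m / 2 + n / 2) 2)

[m+n+c]/2≡m/2+n/2+[m%2+n%2+c]/2 : ∀ m n c → (m + n + c) / 2 ≡ m / 2 + n / 2 + (m % 2 + n % 2 + c) / 2
[m+n+c]/2≡m/2+n/2+[m%2+n%2+c]/2 m n c = begin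
  (m + n + c) / 2        ≡⟨ cong (_/ 2) (m+n+c≡[m%2+n%2+c]+[m/2+n/2]*2 m n c) ⟩
  (low + high * 2) / 2   ≡⟨ +-distrib-/-∣ʳ low (divides high refl) ⟩
  low / 2 + high * 2 / 2 ≡⟨ cong (low / 2 +_) (m*n/n≡m high 2) ⟩
  low / 2 + high         ≡⟨ +-comm (low / 2) high ⟩
  high + low / 2         ∎
  where
    open ≡-Reasoning
    low  = m % 2 + n % 2 + c
    high = m / 2 + n / 2

⌊m+n/2^k⌋≡⌊m/2^k⌋+⌊n/2^k⌋+carry : ∀ m n k →
  ⌊ m + n /2^ k ⌋ ≡ ⌊ m /2^ k ⌋ + ⌊ n /2^ k ⌋ + carry m n k
⌊m+n/2^k⌋≡⌊m/2^k⌋+⌊n/2^k⌋+carry m n zero = begin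
  (m + n) / 1       ≡⟨ n/1≡n (m + n) ⟩
  m + n             ≡⟨ cong₂ _+_ (n/1≡n m) (n/1≡n n) ⟨
  m / 1 + n / 1     ≡⟨ +-identityʳ _ ⟨
  m / 1 + n / 1 + 0 ∎
  where open ≡-Reasoning
⌊m+n/2^k⌋≡⌊m/2^k⌋+⌊n/2^k⌋+carry m n (suc k) = begin
  ⌊ m + n /2^ suc k ⌋
    ≡⟨ ⌊m/2^[1+k]⌋≡⌊m/2^k⌋/2 (m + n) k ⟩
  ⌊ m + n /2^ k ⌋ / 2
    ≡⟨ cong (_/ 2) (⌊m+n/2^k⌋≡⌊m/2^k⌋+⌊n/2^k⌋+carry m n k) ⟩
  (⌊ m /2^ k ⌋ + ⌊ n /2^ k ⌋ + carry m n k) / 2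
    ≡⟨ [m+n+c]/2≡m/2+n/2+[m%2+n%2+c]/2 ⌊ m /2^ k ⌋ ⌊ n /2^ k ⌋ (carry m n k) ⟩
  ⌊ m /2^ k ⌋ / 2 + ⌊ n /2^ k ⌋ / 2 + carry m n (suc k)
    ≡⟨ cong₂ (λ i j → i + j + carry m n (suc k))
             (⌊m/2^[1+k]⌋≡⌊m/2^k⌋/2 m k) (⌊m/2^[1+k]⌋≡⌊m/2^k⌋/2 n k) ⟨
  ⌊ m /2^ suc k ⌋ + ⌊ n /2^ suc k ⌋ + carry m n (suc k)
    ∎
  where open ≡-Reasoning

I-+ : ∀ m n k → I (suc k) (m + n) ≡ (I (suc k) m + I (suc k) n + carry m n k) % 2
I-+ m n k = trans (cong (_% 2) (⌊m+n/2^k⌋≡⌊m/2^k⌋+⌊n/2^k⌋+carry m n k))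
                  ([m+n+c]%2≡[m%2+n%2+c]%2 ⌊ m /2^ k ⌋ ⌊ n /2^ k ⌋ (carry m n k))

carry-vanishes : ∀ m n k → m + n < 2 ^ k → carry m n k ≡ 0
carry-vanishes m n k m+n<2^k = m+n≡0⇒n≡0 (⌊ m /2^ k ⌋ + ⌊ n /2^ k ⌋)
  (trans (sym (⌊m+n/2^k⌋≡⌊m/2^k⌋+⌊n/2^k⌋+carry m n k)) (m<n⇒m/n≡0 {{m^n≢0 2 k}} m+n<2^k))

n<2^n : ∀ n → n < 2 ^ n
n<2^n zero    = s≤s z≤n
n<2^n (suc n) = subst (suc n <_) (cong (2 ^ n +_) (sym (+-identityʳ (2 ^ n))))
                      (≤-<-trans (n<2^n n) (m<m+n (2 ^ n) (m^n>0 2 n)))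

-- A recogniser for P

-- After the columns at positions 0, …, k − 1 of a standardized ⟨w,x,y,z⟩ have been read:
-- below-a while k ≤ a, below-b while a < k ≤ b, and so on up to d; above-d is the part
-- of condition (5) beyond d, and done means one of (1)–(4) has been verified already.
data State : Set where
  below-a below-b below-c below-d above-d done : State

data Final : State → Set where
  above-d : Final above-d
  done    : Final done

-- Positions are 0-based: the digit at position k is I (suc k).
column : ∀ {n} → ℕ → Vec ℕ n → Vec ℕ n
column k = map (I (suc k))

step : State → Vec ℕ 4 → Maybe State
step below-a (0 ∷ 0 ∷ 0 ∷ 0 ∷ []) = just below-a
step below-a (1 ∷ 1 ∷ 1 ∷ 1 ∷ []) = just done
step below-a (1 ∷ 0 ∷ 0 ∷ 0 ∷ []) = just below-b
step below-b (_ ∷ 0 ∷ 0 ∷ 0 ∷ []) = just below-b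
step below-b (0 ∷ 1 ∷ 1 ∷ 1 ∷ []) = just done
step below-b (1 ∷ 1 ∷ 0 ∷ 0 ∷ []) = just below-c
step below-c (w ∷ x ∷ 0 ∷ 0 ∷ []) = if does (1 ≤? w + x) then just below-c else nothing
step below-c (0 ∷ 0 ∷ 1 ∷ 1 ∷ []) = just done
step below-c (1 ∷ 1 ∷ 1 ∷ 0 ∷ []) = just below-d
step below-d (w ∷ x ∷ y ∷ 0 ∷ []) = if does (2 ≤? w + x + y) then just below-d else nothing
step below-d (0 ∷ 0 ∷ 0 ∷ 1 ∷ []) = just done
step below-d (1 ∷ 1 ∷ 1 ∷ 1 ∷ []) = just above-d
step above-d (w ∷ x ∷ y ∷ z ∷ []) =
  let s = w + x + y + z in if does ((s ≟ 0) ⊎-dec (s ≟ 3) ⊎-dec (s ≟ 4)) then just above-d else nothing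
step done _ = just done
step _ _ = nothing

below-c-stays : ∀ w x → 1 ≤ w + x → step below-c (w ∷ x ∷ 0 ∷ 0 ∷ []) ≡ just below-c
below-c-stays w x 1≤w+x rewrite dec-true (1 ≤? w + x) 1≤w+x = refl

below-d-stays : ∀ w x y → 2 ≤ w + x + y → step below-d (w ∷ x ∷ y ∷ 0 ∷ []) ≡ just below-d
below-d-stays w x y 2≤w+x+y rewrite dec-true (2 ≤? w + x + y) 2≤w+x+y = refl

above-d-stays : ∀ w x y z → let s = w + x + y + z in (s ≡ 0 ⊎ s ≡ 3 ⊎ s ≡ 4) →
                step above-d (w ∷ x ∷ y ∷ z ∷ []) ≡ just above-d
above-d-stays w x y z s∈034 with s ← w + x + y + z
  rewrite dec-true ((s ≟ 0) ⊎-dec (s ≟ 3) ⊎-dec (s ≟ 4)) s∈034 = refl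

run : Vec ℕ 4 → ℕ → Maybe State
run ps zero    = just below-a
run ps (suc k) = run ps k >>= λ st → step st (column k ps)

Accepted : Vec ℕ 4 → ℕ → Set
Accepted ps K = ∃[ st ] run ps K ≡ just st × Final st

run-step : ∀ {ps k st st′} → run ps k ≡ just st → step st (column k ps) ≡ just st′ →
           run ps (suc k) ≡ just st′
run-step r s rewrite r = s

run-stay : ∀ {ps i j st} → run ps i ≡ just st →
           (∀ {k} → i ≤ k → k < j → step st (column k ps) ≡ just st) → i ≤ j → run ps j ≡ just st
run-stay {j = zero} r _ z≤n = r
run-stay {j = suc j} r stay i≤1+j with m≤n⇒m<n∨m≡n i≤1+j
... | inj₂ refl  = r
... | inj₁ i<1+j =
  run-step {k = j} (run-stay r (λ i≤k k<j → stay i≤k (m<n⇒m<1+n k<j)) i≤j) (stay i≤j ≤-refl)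
  where i≤j = s≤s⁻¹ i<1+j

column-≡ : ∀ k {w x y z w′ x′ y′ z′} →
           I (suc k) w ≡ w′ → I (suc k) x ≡ x′ → I (suc k) y ≡ y′ → I (suc k) z ≡ z′ →
           column k (w ∷ x ∷ y ∷ z ∷ []) ≡ w′ ∷ x′ ∷ y′ ∷ z′ ∷ []
column-≡ k refl refl refl refl = refl

module Recognition {w x y z a b c d : ℕ} (vw : V2 w a) (vx : V2 x b) (vy : V2 y c) (vz : V2 z d)
                   (a≤b : a ≤ b) (b≤c : b ≤ c) (c≤d : c ≤ d) where

  ps : Vec ℕ 4
  ps = w ∷ x ∷ y ∷ z ∷ []

  private
    b≤d = ≤-trans b≤c c≤d
    a≤c = ≤-trans a≤b b≤c
    a≤d = ≤-trans a≤b b≤d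

    <⇒+2≤suc : ∀ {v k} → v < k → v + 2 ≤ suc k
    <⇒+2≤suc {v} {k} v<k = subst (_≤ suc k) (+-comm 2 v) (s≤s v<k)

  w↓ : ∀ {k} → k < a → I (suc k) w ≡ 0
  w↓ = I-below-valuation a (proj₁ vw)
  x↓ : ∀ {k} → k < b → I (suc k) x ≡ 0
  x↓ = I-below-valuation b (proj₁ vx)
  y↓ : ∀ {k} → k < c → I (suc k) y ≡ 0
  y↓ = I-below-valuation c (proj₁ vy)
  z↓ : ∀ {k} → k < d → I (suc k) z ≡ 0
  z↓ = I-below-valuation d (proj₁ vz)

  w↑ : ∀ {k} → k ≡ a → I (suc k) w ≡ 1
  w↑ refl = I-at-valuation a vw
  x↑ : ∀ {k} → k ≡ b → I (suc k) x ≡ 1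
  x↑ refl = I-at-valuation b vx
  y↑ : ∀ {k} → k ≡ c → I (suc k) y ≡ 1
  y↑ refl = I-at-valuation c vy
  z↑ : ∀ {k} → k ≡ d → I (suc k) z ≡ 1
  z↑ refl = I-at-valuation d vz

  accepted-after : ∀ {e st} → e ≤ d → run ps (suc e) ≡ just st → Final st →
                   (∀ {k} → suc e ≤ k → step st (column k ps) ≡ just st) → ∀ K → d < K → Accepted ps K
  accepted-after e≤d r final stay K d<K = _ , run-stay r (λ e<k _ → stay e<k) (≤-trans (s≤s e≤d) d<K) , final

  accepted-done : ∀ {e} → e ≤ d → run ps (suc e) ≡ just done → ∀ K → d < K → Accepted ps K
  accepted-done e≤d r = accepted-after e≤d r done (λ _ → refl)

  run-a : run ps a ≡ just below-a
  run-a = run-stay refl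
    (λ {k} _ k<a → cong (step below-a)
      (column-≡ k (w↓ k<a) (x↓ (<-≤-trans k<a a≤b)) (y↓ (<-≤-trans k<a a≤c)) (z↓ (<-≤-trans k<a a≤d))))
    z≤n

  condition-1 : a ≡ b → b ≡ c → c ≡ d → ∀ K → d < K → Accepted ps K
  condition-1 a≡b b≡c c≡d = accepted-done a≤d
    (run-step {k = a} run-a (cong (step below-a)
      (column-≡ a (w↑ refl) (x↑ a≡b) (y↑ (trans a≡b b≡c)) (z↑ (trans a≡b (trans b≡c c≡d))))))

  module _ (a<b : a < b) where
    run-b : run ps b ≡ just below-b
    run-b = run-stay
      (run-step {k = a} run-a (cong (step below-a)
        (column-≡ a (w↑ refl) (x↓ a<b) (y↓ (<-≤-trans a<b b≤c)) (z↓ (<-≤-trans a<b b≤d)))))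
      (λ {k} _ k<b → cong (step below-b)
        (column-≡ k refl (x↓ k<b) (y↓ (<-≤-trans k<b b≤c)) (z↓ (<-≤-trans k<b b≤d))))
      a<b

    condition-2 : b ≡ c → c ≡ d → I (suc b) w ≡ 0 → ∀ K → d < K → Accepted ps K
    condition-2 b≡c c≡d w₀ = accepted-done b≤d
      (run-step {k = b} run-b (cong (step below-b) (column-≡ b w₀ (x↑ refl) (y↑ b≡c) (z↑ (trans b≡c c≡d)))))

    module _ (b<c : b < c) (w+x≥1 : ∀ k → b + 2 ≤ k → k ≤ c → 1 ≤ I k w + I k x)
             (wb₁ : I (suc b) w ≡ 1) where
      run-c : run ps c ≡ just below-c
      run-c = run-stay
        (run-step {k = b} run-b (cong (step below-b)
          (column-≡ b wb₁ (x↑ refl) (y↓ b<c) (z↓ (<-≤-trans b<c c≤d)))))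
        (λ {k} b<k k<c →
          trans (cong (step below-c) (column-≡ k refl refl (y↓ k<c) (z↓ (<-≤-trans k<c c≤d))))
                (below-c-stays (I (suc k) w) (I (suc k) x) (w+x≥1 (suc k) (<⇒+2≤suc b<k) k<c)))
        b<c

      condition-3 : c ≡ d → I (suc c) w ≡ 0 → I (suc c) x ≡ 0 → ∀ K → d < K → Accepted ps K
      condition-3 c≡d w₀ x₀ = accepted-done c≤d
        (run-step {k = c} run-c (cong (step below-c) (column-≡ c w₀ x₀ (y↑ refl) (z↑ c≡d))))

      module _ (c<d : c < d) (w+x+y≥2 : ∀ j → c + 2 ≤ j → j ≤ d → 2 ≤ I j w + I j x + I j y)
               (wc₁ : I (suc c) w ≡ 1) (xc₁ : I (suc c) x ≡ 1) where
        run-d : run ps d ≡ just below-d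
        run-d = run-stay
          (run-step {k = c} run-c (cong (step below-c) (column-≡ c wc₁ xc₁ (y↑ refl) (z↓ c<d))))
          (λ {k} c<k k<d →
            trans (cong (step below-d) (column-≡ k refl refl refl (z↓ k<d)))
                  (below-d-stays (I (suc k) w) (I (suc k) x) (I (suc k) y) (w+x+y≥2 (suc k) (<⇒+2≤suc c<k) k<d)))
          c<d

        condition-4 : I (suc d) w ≡ 0 → I (suc d) x ≡ 0 → I (suc d) y ≡ 0 → ∀ K → d < K → Accepted ps K
        condition-4 w₀ x₀ y₀ = accepted-done ≤-refl
          (run-step {k = d} run-d (cong (step below-d) (column-≡ d w₀ x₀ y₀ (z↑ refl))))

        condition-5 : (∀ i → d + 2 ≤ i → let s = I i w + I i x + I i y + I i z in (s ≡ 0 ⊎ s ≡ 3 ⊎ s ≡ 4)) →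
                      I (suc d) w ≡ 1 → I (suc d) x ≡ 1 → I (suc d) y ≡ 1 → ∀ K → d < K → Accepted ps K
        condition-5 s∈034 w₁ x₁ y₁ = accepted-after ≤-refl
          (run-step {k = d} run-d (cong (step below-d) (column-≡ d w₁ x₁ y₁ (z↑ refl))))
          above-d
          (λ {k} d<k → above-d-stays (I (suc k) w) (I (suc k) x) (I (suc k) y) (I (suc k) z)
                                      (s∈034 (suc k) (<⇒+2≤suc d<k)))

  Cond⇒accepted : Cond w x y z a b c d → ∀ K → d < K → Accepted ps K
  Cond⇒accepted (inj₁ (a≡b , b≡c , c≡d)) =
    condition-1 a≡b b≡c c≡d
  Cond⇒accepted (inj₂ (inj₁ (a<b , b≡c , c≡d , wb₀))) =
    condition-2 a<b b≡c c≡d wb₀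
  Cond⇒accepted (inj₂ (inj₂ (inj₁ (a<b , b<c , c≡d , wc₀ , xc₀ , w+x≥1 , wb₁)))) =
    condition-3 a<b b<c w+x≥1 wb₁ c≡d wc₀ xc₀
  Cond⇒accepted (inj₂ (inj₂ (inj₂ (inj₁
    (a<b , b<c , c<d , wd₀ , xd₀ , yd₀ , w+x+y≥2 , wc₁ , xc₁ , w+x≥1 , wb₁))))) =
    condition-4 a<b b<c w+x≥1 wb₁ c<d w+x+y≥2 wc₁ xc₁ wd₀ xd₀ yd₀
  Cond⇒accepted (inj₂ (inj₂ (inj₂ (inj₂
    (a<b , b<c , c<d , s∈034 , wd₁ , xd₁ , yd₁ , w+x+y≥2 , wc₁ , xc₁ , w+x≥1 , wb₁))))) =
    condition-5 a<b b<c w+x≥1 wb₁ c<d w+x+y≥2 wc₁ xc₁ s∈034 wd₁ xd₁ yd₁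

arrange : ∀ {A : Set} {m n} → Vec (Fin n) m → Vec A n → Vec A m
arrange σ v = map (lookup v) σ

column-arrange : ∀ k {m n} (σ : Vec (Fin n) m) v → column k (arrange σ v) ≡ arrange σ (column k v)
column-arrange k σ v =
  trans (sym (map-∘ (I (suc k)) (lookup v) σ)) (map-cong (λ i → sym (lookup-map i (I (suc k)) v)) σ)

lookup-fromList : ∀ {A : Set} (xs : List A) i → lookup (fromList xs) i ≡ List.lookup xs i
lookup-fromList (x ∷ xs) zero    = refl
lookup-fromList (x ∷ xs) (suc i) = lookup-fromList xs i

↭⇒arrangement : ∀ {A : Set} {xs ys : List A} → xs ↭ ys →
                ∃[ σ ] Unique σ × fromList xs ≡ arrange σ (fromList ys)
↭⇒arrangement {A = A} {xs} {ys} xs↭ys =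
  tabulate ρ , tabulate⁺ (Injection.injective (↔⇒↣ indices)) , (begin
  fromList xs                         ≡⟨ tabulate∘lookup (fromList xs) ⟨
  tabulate (lookup (fromList xs))     ≡⟨ tabulate-cong lookup-ρ ⟩
  tabulate (lookup (fromList ys) ∘ ρ) ≡⟨ tabulate-∘ (lookup (fromList ys)) ρ ⟩
  arrange (tabulate ρ) (fromList ys)  ∎)
  where
    open ≡-Reasoning
    open import Relation.Binary.PropositionalEquality.Properties using (setoid)
    open import Data.List.Relation.Binary.Permutation.Setoid (setoid A) using (onIndices)
    open import Data.List.Relation.Binary.Permutation.Setoid.Properties (setoid A) using (onIndices-lookup)
    indices = onIndices (↭⇒↭ₛ xs↭ys)
    ρ = Inverse.to indices
    lookup-ρ : ∀ i → lookup (fromList xs) i ≡ lookup (fromList ys) (ρ i)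
    lookup-ρ i = trans (lookup-fromList xs i)
                       (trans (onIndices-lookup (↭⇒↭ₛ xs↭ys) i) (sym (lookup-fromList ys (ρ i))))

-- Simulating a move

Joint : Set
Joint = State × State × ℕ

initial : Joint
initial = below-a , below-a , 0

-- One column of the move ⟨r,s,t,u⟩ ↦ ⟨t,u,m,n⟩: the digit of s = m + n comes from those
-- of m and n and the carry c, and the recogniser reads both positions arranged by σ and τ.
jointStep : Vec (Fin 4) 4 → Vec (Fin 4) 4 → Joint → (r t u m n : ℕ) → Maybe Joint
jointStep σ τ (sp , sq , c) r t u m n =
  zipWith (λ sp′ sq′ → sp′ , sq′ , (m + n + c) / 2)
          (step sp (arrange σ (r ∷ (m + n + c) % 2 ∷ t ∷ u ∷ [])))
          (step sq (arrange τ (t ∷ u ∷ m ∷ n ∷ [])))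

Closed : Vec (Fin 4) 4 → Vec (Fin 4) 4 → List Joint → Joint → Set
Closed σ τ R j = ∀ {r} → r < 2 → ∀ {t} → t < 2 → ∀ {u} → u < 2 → ∀ {m} → m < 2 → ∀ {n} → n < 2 →
                 Maybe.All (_∈ R) (jointStep σ τ j r t u m n)

Safe : Joint → Set
Safe (sp , sq , c) = ¬ (Final sp × Final sq × c ≡ 0)

Certificate : Vec (Fin 4) 4 → Vec (Fin 4) 4 → List Joint → Set
Certificate σ τ R = initial ∈ R × All (Closed σ τ R) R × All Safe R

module Simulation {σ τ : Vec (Fin 4) 4} {R : List Joint} (certificate : Certificate σ τ R)
                  {r s t u m n : ℕ} (m+n≡s : m + n ≡ s) where

  P Q : Vec ℕ 4
  P = arrange σ (r ∷ s ∷ t ∷ u ∷ [])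
  Q = arrange τ (t ∷ u ∷ m ∷ n ∷ [])

  column-P : ∀ k → column k P ≡ arrange σ (I (suc k) r ∷ (I (suc k) m + I (suc k) n + carry m n k) % 2
                                            ∷ I (suc k) t ∷ I (suc k) u ∷ [])
  column-P k = trans (column-arrange k σ (r ∷ s ∷ t ∷ u ∷ []))
    (cong (λ e → arrange σ (I (suc k) r ∷ e ∷ I (suc k) t ∷ I (suc k) u ∷ []))
          (trans (cong (I (suc k)) (sym m+n≡s)) (I-+ m n k)))

  runs∈R : ∀ k {sp sq} → run P k ≡ just sp → run Q k ≡ just sq → (sp , sq , carry m n k) ∈ R
  runs∈R zero refl refl = proj₁ certificate
  runs∈R (suc k) eP eQ with run P k in eP₀ | run Q k in eQ₀
  runs∈R (suc k) () _ | nothing | _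
  runs∈R (suc k) _ () | just _  | nothing
  runs∈R (suc k) {sp} {sq} eP eQ | just sp₀ | just sq₀ =
    Maybe.drop-just (subst (Maybe.All (_∈ R)) jointStep≡
      (All.lookup (proj₁ (proj₂ certificate)) (runs∈R k eP₀ eQ₀)
                  (I<2 k r) (I<2 k t) (I<2 k u) (I<2 k m) (I<2 k n)))
    where
      jointStep≡ : jointStep σ τ (sp₀ , sq₀ , carry m n k)
                             (I (suc k) r) (I (suc k) t) (I (suc k) u) (I (suc k) m) (I (suc k) n)
                   ≡ just (sp , sq , carry m n (suc k))
      jointStep≡ = cong₂ (zipWith λ sp′ sq′ → sp′ , sq′ , carry m n (suc k))
                         (trans (cong (step sp₀) (sym (column-P k))) eP)
                         (trans (cong (step sq₀) (sym (column-arrange k τ (t ∷ u ∷ m ∷ n ∷ [])))) eQ)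

  not-both-accepted : ∀ K → s < 2 ^ K → Accepted P K → Accepted Q K → ⊥
  not-both-accepted K s<2^K (sp , eP , final-sp) (sq , eQ , final-sq) =
    All.lookup (proj₂ (proj₂ certificate)) (runs∈R K eP eQ)
      (final-sp , final-sq , carry-vanishes m n K (subst (_< 2 ^ K) (sym m+n≡s) s<2^K))

-- Checking every pair of arrangements

State-code : State → ℕ
State-code below-a = 0
State-code below-b = 1
State-code below-c = 2
State-code below-d = 3
State-code above-d = 4
State-code done    = 5

State-decode : ℕ → State
State-decode 0 = below-a
State-decode 1 = below-b
State-decode 2 = below-c
State-decode 3 = below-d
State-decode 4 = above-d
State-decode _ = done

State-decode∘code : ∀ st → State-decode (State-code st) ≡ st
State-decode∘code below-a = refl
State-decode∘code below-b = refl
State-decode∘code below-c = refl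
State-decode∘code below-d = refl
State-decode∘code above-d = refl
State-decode∘code done    = refl

_≟ˢ_ : DecidableEquality State
_≟ˢ_ = eq? (mk↣ λ {st} {st′} e →
  trans (sym (State-decode∘code st)) (trans (cong State-decode e) (State-decode∘code st′)))

_≟ᴶ_ : DecidableEquality Joint
_≟ᴶ_ = ≡-dec _≟ˢ_ (≡-dec _≟ˢ_ _≟_)

open import Data.List.Membership.DecPropositional _≟ᴶ_ using (_∈?_)

final? : Decidable Final
final? below-a = no λ ()
final? below-b = no λ ()
final? below-c = no λ ()
final? below-d = no λ ()
final? above-d = yes above-d
final? done    = yes done

certificate? : ∀ σ τ R → Dec (Certificate σ τ R)
certificate? σ τ R = initial ∈? R ×-dec All.all? closed? R ×-dec All.all? safe? R
  where
    closed? : Decidable (Closed σ τ R)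
    closed? j = allUpTo? (λ r → allUpTo? (λ t → allUpTo? (λ u → allUpTo? (λ m → allUpTo? (λ n →
                  Maybe.dec (_∈? R) (jointStep σ τ j r t u m n)) 2) 2) 2) 2) 2
    safe? : Decidable Safe
    safe? (sp , sq , c) = ¬? (final? sp ×-dec final? sq ×-dec c ≟ 0)

-- Worklist search with fuel; its output is trusted only through certificate?.
module _ {A : Set} (_≟_ : DecidableEquality A) (next : A → List A) where
  open import Data.List.Membership.DecPropositional _≟_ using (_∉?_)

  explore : ℕ → List A → List A → List A
  explore zero       seen _          = seen
  explore (suc fuel) seen []         = seen
  explore (suc fuel) seen (x ∷ todo) = explore fuel (new ++ seen) (new ++ todo)
    where new = deduplicate _≟_ (filter (_∉? seen) (next x))

successors : Vec (Fin 4) 4 → Vec (Fin 4) 4 → Joint → List Joint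
successors σ τ j =
  concatMap (λ r → concatMap (λ t → concatMap (λ u → concatMap (λ m → concatMap (λ n →
    fromMaybe (jointStep σ τ j r t u m n)) bits) bits) bits) bits) bits
  where bits = 0 ∷ 1 ∷ []

reachable : Vec (Fin 4) 4 → Vec (Fin 4) 4 → List Joint
reachable σ τ = explore _≟ᴶ_ (successors σ τ) 100 [ initial ] [ initial ]

∀-Vec? : ∀ {m} n {P : Pred (Vec (Fin m) n) 0ℓ} → Decidable P → Dec (∀ v → P v)
∀-Vec? zero    P? = map′ (λ p → λ { [] → p }) (λ f → f []) (P? [])
∀-Vec? (suc n) P? =
  map′ (λ f → λ { (i ∷ v) → f i v }) (λ f i v → f (i ∷ v)) (all? λ i → ∀-Vec? n (P? ∘ (i ∷_)))

unique? : ∀ {m n} → Decidable (Unique {A = Fin m} {n})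
unique? = allPairs? (λ i j → ¬? (i Fin.≟ j))

reachable-certified : ∀ σ → Unique σ → ∀ τ → Unique τ → Certificate σ τ (reachable σ τ)
reachable-certified = from-yes
  (∀-Vec? 4 λ σ → unique? σ →-dec ∀-Vec? 4 λ τ → unique? τ →-dec certificate? σ τ (reachable σ τ))

lemma3p1 : (p q : Pos) → Valid p → InP p → Move p q → ¬ InP q
lemma3p1 ⟨ _ , _ , _ , _ ⟩ ⟨ _ , _ , _ , _ ⟩ _
  (w , x , y , z , a , b , c , d , p↭wxyz , vw , vx , vy , vz , a≤b , b≤c , c≤d , cond)
  (r , s , t , u , m , n , p↭rstu , _ , _ , m+n≡s , q↭tumn)
  (w′ , x′ , y′ , z′ , a′ , b′ , c′ , d′ , q↭w′x′y′z′ ,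
   vw′ , vx′ , vy′ , vz′ , a′≤b′ , b′≤c′ , c′≤d′ , cond′)
  with ↭⇒arrangement (↭-trans (↭-sym p↭wxyz) p↭rstu)
     | ↭⇒arrangement (↭-trans (↭-sym q↭w′x′y′z′) q↭tumn)
... | σ , σ-unique , wxyz≡σ[rstu] | τ , τ-unique , w′x′y′z′≡τ[tumn] =
  Simulation.not-both-accepted (reachable-certified σ σ-unique τ τ-unique) m+n≡s K s<2^K
    (subst (λ ps → Accepted ps K) wxyz≡σ[rstu]
           (Recognition.Cond⇒accepted vw vx vy vz a≤b b≤c c≤d cond K d<K))
    (subst (λ ps → Accepted ps K) w′x′y′z′≡τ[tumn]
           (Recognition.Cond⇒accepted vw′ vx′ vy′ vz′ a′≤b′ b′≤c′ c′≤d′ cond′ K d′<K))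
  where
    K = s + suc (d + d′)
    s<2^K : s < 2 ^ K
    s<2^K = ≤-<-trans (m≤m+n s _) (n<2^n K)
    d<K : d < K
    d<K = ≤-trans (s≤s (m≤m+n d d′)) (m≤n+m _ s)
    d′<K : d′ < K
    d′<K = ≤-trans (s≤s (m≤n+m d′ d)) (m≤n+m _ s)
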